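{- Let $0\le\ell\le n$, let $I$, $J$ be the $n\times n$ identity and all-ones matrices, and let $s,t$ be scalars. Then $$\operatorname{tr}(sI+tJ)^{\vee\ell}=\frac{n!}{(n-\ell)!}\sum_{0\le k\le\ell}\frac{s^k t^{\ell-k}}{k!}.$$
   Context: For an $n\times n$ matrix $Y$, $Y^{\vee\ell}$ is the $\binom n\ell\times\binom n\ell$ matrix indexed by $\ell$-subsets of $\{1,\dots,n\}$ whose $(\mathrm{S},\mathrm{T})$ entry is the permanent of the submatrix of $Y$ with rows $\mathrm{S}$ and columns $\mathrm{T}$ ($Y^{\vee0}=[1]$). -}

module Defs where

open import Level using (Level)
open import Algebra.Bundles using (CommutativeRing)
open import Data.Nat as ℕ using (ℕ; zero; suc; _∸_; _/_)
open import Data.Nat.Base using (_!)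
open import Data.Nat.Properties using (m*n≢0; _!≢0)
open import Data.Fin as Fin using (Fin; zero; suc)
open import Data.Vec as Vec using (Vec; []; _∷_; lookup)
open import Data.List as List using (List; []; _∷_; _++_; concatMap; upTo)
open import Data.Bool using (if_then_else_)
open import Relation.Nullary.Decidable using (⌊_⌋)

-- ℓ-subsets of {0,…,n-1}, each listed as a strictly increasing vector of length ℓ.
combinations : (n ℓ : ℕ) → List (Vec (Fin n) ℓ)
combinations n       zero    = [] ∷ []
combinations zero    (suc ℓ) = []
combinations (suc n) (suc ℓ) =
  List.map (λ v → zero ∷ Vec.map suc v) (combinations n ℓ)
  ++ List.map (Vec.map suc) (combinations n (suc ℓ))

-- all permutations of Fin m, as vectors listing σ(0),…,σ(m-1)
insertAt : ∀ {A : Set} {m} → Fin (suc m) → A → Vec A m → Vec A (suc m)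
insertAt zero    x xs       = x ∷ xs
insertAt (suc i) x (y ∷ xs) = y ∷ insertAt i x xs

permutations : (m : ℕ) → List (Vec (Fin m) m)
permutations zero    = [] ∷ []
permutations (suc m) =
  concatMap (λ σ → List.map (λ i → insertAt i zero (Vec.map suc σ)) (List.allFin (suc m)))
            (permutations m)

module _ {c ℓ′ : Level} (R : CommutativeRing c ℓ′) where
  open CommutativeRing R using (Carrier; _+_; _*_; 0#; 1#)

  Matrix : ℕ → Set c
  Matrix n = Fin n → Fin n → Carrier

  sumL : ∀ {A : Set} → (A → Carrier) → List A → Carrier
  sumL f []       = 0#
  sumL f (x ∷ xs) = f x + sumL f xs

  prodF : (m : ℕ) → (Fin m → Carrier) → Carrier
  prodF zero    f = 1#
  prodF (suc m) f = f zero * prodF m (λ i → f (suc i))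

  permanent : ∀ {m} → Matrix m → Carrier
  permanent {m} M = sumL (λ σ → prodF m (λ i → M i (lookup σ i))) (permutations m)

  vee : ∀ {n} → Matrix n → (ℓ : ℕ) → Vec (Fin n) ℓ → Vec (Fin n) ℓ → Carrier
  vee Y ℓ S T = permanent (λ i j → Y (lookup S i) (lookup T j))

  traceVee : ∀ {n} → Matrix n → ℕ → Carrier
  traceVee {n} Y ℓ = sumL (λ S → vee Y ℓ S S) (combinations n ℓ)

  identityM : ∀ {n} → Matrix n
  identityM i j = if ⌊ i Fin.≟ j ⌋ then 1# else 0#

  onesM : ∀ {n} → Matrix n
  onesM i j = 1#

  _·M_ : ∀ {n} → Carrier → Matrix n → Matrix n
  (a ·M M) i j = a * M i j

  _+M_ : ∀ {n} → Matrix n → Matrix n → Matrix n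
  (M +M N) i j = M i j + N i j

  _×_ : ℕ → Carrier → Carrier
  ℕ.zero  × x = 0#
  ℕ.suc k × x = x + k × x

  _^_ : Carrier → ℕ → Carrier
  x ^ ℕ.zero  = 1#
  x ^ ℕ.suc k = x * x ^ k

-- the natural number n! / ((n-ℓ)! k!)  (exact for k ≤ ℓ ≤ n)
coeff : ℕ → ℕ → ℕ → ℕ
coeff n ℓ k = (n !) / ((n ∸ ℓ) ! ℕ.* k !)
  where instance _ = m*n≢0 ((n ∸ ℓ) !) (k !) {{(n ∸ ℓ) !≢0}} {{k !≢0}}

-- For an ℓ-subset S, the diagonal entry of (sI + tJ)^{∨ℓ} at S is the permanent of the ℓ × ℓ
-- matrix with s + t on the diagonal and t elsewhere, so the trace is C(n,ℓ) times this permanent.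
-- More generally, let an m × m matrix have entries t except for k "marked" cells, in distinct rows
-- and columns, which hold s + t; its permanent is Σ_j C(k,j) (m-j)! s^j t^(m-j), by induction on m
-- via expansion along the first column.  If that column holds a mark, it is t times the all-ones
-- column plus s times a unit column, which trades one mark for a factor s and a minor; if it holds
-- no mark, each minor has k or k - 1 marks and absorption k C(k-1,j) + j C(k,j) = k C(k,j) closes
-- the recursion.  Finally C(n,ℓ) C(ℓ,j) (ℓ-j)! = n! / ((n-ℓ)! j!).

module Submission where

open import Level using (Level)
open import Algebra.Bundles using (CommutativeRing)
open import Data.Nat using (ℕ; _≤_; _∸_)
open import Data.List using (upTo)
open import Defs hiding (_×_; _^_)

import Data.Nat.Base as ℕ
import Data.Nat.Properties as ℕₚ
open import Data.Nat.Base using (zero; suc; _<_; _!; s≤s; z≤n)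
open import Data.Nat.Combinatorics using (_C_)
open import Data.Bool.Base using (Bool; true; false; not; if_then_else_)
open import Data.Bool.Properties using (if-float)
open import Data.Empty using (⊥-elim)
open import Data.Fin.Base using (Fin; zero; suc; toℕ; punchIn)
import Data.Fin.Base as Fin
open import Data.Fin.Properties
  using (_≟_; any?; injective⇒≤; punchIn-injective; punchInᵢ≢i; toℕ<n; toℕ-inject₁; toℕ-fromℕ)
open import Data.List.Base using (List; []; _∷_; _++_; concatMap; tabulate; allFin; length)
import Data.List.Base as List
open import Data.List.Relation.Unary.All using (All; []; _∷_)
import Data.List.Relation.Unary.All as All
open import Data.Maybe.Base using (Maybe; just; nothing; is-just)
import Data.Maybe.Base as Maybe
import Data.Maybe.Properties as Maybe
open import Data.Product using (∃; _,_; proj₁; proj₂)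
open import Data.Vec.Base using (Vec; _∷_; lookup)
import Data.Vec.Base as Vec
open import Data.Vec.Properties using (lookup-map)
open import Function.Definitions using (Injective)
open import Relation.Nullary using (Dec; yes; no)
open import Relation.Nullary.Decidable using (⌊_⌋; does)
open import Relation.Nullary.Negation using (¬∃⟶∀¬)
open import Relation.Binary.PropositionalEquality
  using (_≡_; _≢_; refl; sym; trans; cong; cong₂; subst; module ≡-Reasoning)

module Binomial where

  open import Data.Nat.Base using (_+_; _*_)
  open import Data.Nat.Properties
    using ( *-zeroʳ; *-identityʳ; *-distribˡ-+; *-distribʳ-+; +-assoc; +-comm; +-identityʳ; +-suc
          ; +-∸-assoc; m∸n+n≡m; +-cancelʳ-≡; _!≢0; m*n≢0)
  open import Data.Nat.Combinatorics
    using (nCk+nC[k+1]≡[n+1]C[k+1]; nC1≡n; k>n⇒nCk≡0; nCk≡n!/k![n-k]!; k![n∸k]!∣n!)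
  open import Data.Nat.DivMod using (m*n/n≡m; m/n*n≡m; /-congˡ)
  open import Data.Nat.Tactic.RingSolver using (solve-∀)

  [k+1]*[n+1]C[k+1]≡[n+1]*nCk : ∀ n k → suc k * (suc n C suc k) ≡ suc n * (n C k)
  [k+1]*[n+1]C[k+1]≡[n+1]*nCk zero zero = refl
  [k+1]*[n+1]C[k+1]≡[n+1]*nCk zero (suc k)
    rewrite k>n⇒nCk≡0 {1} {suc (suc k)} (s≤s (s≤s z≤n)) | k>n⇒nCk≡0 {0} {suc k} (s≤s z≤n) =
    *-zeroʳ (suc (suc k))
  [k+1]*[n+1]C[k+1]≡[n+1]*nCk (suc n) zero =
    trans (+-identityʳ _) (trans (nC1≡n (suc (suc n))) (sym (*-identityʳ (suc (suc n)))))
  [k+1]*[n+1]C[k+1]≡[n+1]*nCk (suc n) (suc k) = begin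
    suc K * (suc N C suc K)                     ≡⟨ cong (suc K *_) (sym (nCk+nC[k+1]≡[n+1]C[k+1] N K)) ⟩
    suc K * (N C K + N C suc K)                 ≡⟨ *-distribˡ-+ (suc K) (N C K) (N C suc K) ⟩
    N C K + K * (N C K) + suc K * (N C suc K)   ≡⟨ +-assoc (N C K) _ _ ⟩
    N C K + (K * (N C K) + suc K * (N C suc K)) ≡⟨ cong (N C K +_) (cong₂ _+_ (absorb n k) (absorb n K)) ⟩
    N C K + (N * (n C k) + N * (n C K))         ≡⟨ cong (N C K +_) (sym (*-distribˡ-+ N (n C k) (n C K))) ⟩
    N C K + N * (n C k + n C K)                 ≡⟨ cong (λ x → N C K + N * x) (nCk+nC[k+1]≡[n+1]C[k+1] n k) ⟩
    suc N * (N C K)                             ∎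
    where
    open ≡-Reasoning
    N K : ℕ
    N = suc n
    K = suc k
    absorb = [k+1]*[n+1]C[k+1]≡[n+1]*nCk

  n*[n∸1]Ck+k*nCk≡n*nCk : ∀ n k → n * ((n ∸ 1) C k) + k * (n C k) ≡ n * (n C k)
  n*[n∸1]Ck+k*nCk≡n*nCk zero    zero    = refl
  n*[n∸1]Ck+k*nCk≡n*nCk zero    (suc k) rewrite k>n⇒nCk≡0 {0} {suc k} (s≤s z≤n) = *-zeroʳ k
  n*[n∸1]Ck+k*nCk≡n*nCk (suc n) zero    = +-identityʳ _
  n*[n∸1]Ck+k*nCk≡n*nCk (suc n) (suc k) = begin
    suc n * (n C suc k) + suc k * (suc n C suc k)
      ≡⟨ cong (suc n * (n C suc k) +_) ([k+1]*[n+1]C[k+1]≡[n+1]*nCk n k) ⟩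
    suc n * (n C suc k) + suc n * (n C k)
      ≡⟨ sym (*-distribˡ-+ (suc n) (n C suc k) (n C k)) ⟩
    suc n * (n C suc k + n C k)
      ≡⟨ cong (suc n *_) (trans (+-comm (n C suc k) (n C k)) (nCk+nC[k+1]≡[n+1]C[k+1] n k)) ⟩
    suc n * (suc n C suc k) ∎
    where open ≡-Reasoning

  nCk*[k!*[n∸k]!]≡n! : ∀ {n k} → k ≤ n → (n C k) * (k ! * (n ∸ k) !) ≡ n !
  nCk*[k!*[n∸k]!]≡n! {n} {k} k≤n =
    trans (cong (_* (k ! * (n ∸ k) !)) (nCk≡n!/k![n-k]! k≤n))
          (m/n*n≡m {{m*n≢0 _ _ {{k !≢0}} {{(n ∸ k) !≢0}}}} (k![n∸k]!∣n! k≤n))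

  markedCoefficient : ℕ → ℕ → ℕ → ℕ
  markedCoefficient m k j = (k C j) * (m ∸ j) !

  markedCoefficient-suc : ∀ {m k r j} → k + r ≡ m → j ≤ m →
    k * markedCoefficient m (k ∸ 1) j + suc r * markedCoefficient m k j ≡ markedCoefficient (suc m) k j
  markedCoefficient-suc {m} {k} {r} {j} k+r≡m j≤m = begin
    k * (B′ * F) + suc r * (B * F) ≡⟨ factor k B′ (suc r) B F ⟩
    (k * B′ + suc r * B) * F       ≡⟨ cong (_* F) weights ⟩
    (suc (m ∸ j) * B) * F          ≡⟨ swap (suc (m ∸ j)) B F ⟩
    B * (suc (m ∸ j)) !            ≡⟨ cong (λ x → B * x !) (sym (+-∸-assoc 1 j≤m)) ⟩
    B * (suc m ∸ j) !              ∎
    where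
    open ≡-Reasoning
    B B′ F : ℕ
    B  = k C j
    B′ = (k ∸ 1) C j
    F  = (m ∸ j) !
    factor : ∀ a x b y f → a * (x * f) + b * (y * f) ≡ (a * x + b * y) * f
    factor = solve-∀
    swap : ∀ a x f → (a * x) * f ≡ x * (a * f)
    swap = solve-∀
    +-swapʳ : ∀ x y z → x + y + z ≡ x + z + y
    +-swapʳ = solve-∀
    weights : k * B′ + suc r * B ≡ suc (m ∸ j) * B
    weights = +-cancelʳ-≡ (j * B) _ _ (begin
      k * B′ + suc r * B + j * B   ≡⟨ +-swapʳ (k * B′) (suc r * B) (j * B) ⟩
      k * B′ + j * B + suc r * B   ≡⟨ cong (_+ suc r * B) (n*[n∸1]Ck+k*nCk≡n*nCk k j) ⟩
      k * B + suc r * B            ≡⟨ sym (*-distribʳ-+ B k (suc r)) ⟩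
      (k + suc r) * B              ≡⟨ cong (_* B) (trans (+-suc k r) (cong suc k+r≡m)) ⟩
      suc m * B                    ≡⟨ cong (λ x → suc x * B) (sym (m∸n+n≡m j≤m)) ⟩
      suc (m ∸ j + j) * B          ≡⟨ *-distribʳ-+ B (suc (m ∸ j)) j ⟩
      suc (m ∸ j) * B + j * B      ∎)

  markedCoefficient-suc-suc : ∀ m k j →
    markedCoefficient (suc m) (suc k) (suc j) ≡ markedCoefficient (suc m) k (suc j) + markedCoefficient m k j
  markedCoefficient-suc-suc m k j = begin
    (suc k C suc j) * (m ∸ j) !                   ≡⟨ cong (_* (m ∸ j) !) (sym (nCk+nC[k+1]≡[n+1]C[k+1] k j)) ⟩
    (k C j + k C suc j) * (m ∸ j) !               ≡⟨ cong (_* (m ∸ j) !) (+-comm (k C j) (k C suc j)) ⟩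
    (k C suc j + k C j) * (m ∸ j) !               ≡⟨ *-distribʳ-+ ((m ∸ j) !) (k C suc j) (k C j) ⟩
    (k C suc j) * (m ∸ j) ! + (k C j) * (m ∸ j) ! ∎
    where open ≡-Reasoning

  markedCoefficient-beyond : ∀ {m k j} → k < j → markedCoefficient m k j ≡ 0
  markedCoefficient-beyond k<j = cong (_* _) (k>n⇒nCk≡0 k<j)

  coeff≡nCℓ*markedCoefficient : ∀ {n ℓ k} → k ≤ ℓ → ℓ ≤ n → coeff n ℓ k ≡ (n C ℓ) * markedCoefficient ℓ ℓ k
  coeff≡nCℓ*markedCoefficient {n} {ℓ} {k} k≤ℓ ℓ≤n =
    trans (/-congˡ n!≡X*D) (m*n/n≡m X D)
    where
    instance _ = m*n≢0 ((n ∸ ℓ) !) (k !) {{(n ∸ ℓ) !≢0}} {{k !≢0}}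
    X D : ℕ
    X = (n C ℓ) * markedCoefficient ℓ ℓ k
    D = (n ∸ ℓ) ! * k !
    regroup : ∀ a b f g h → (a * (b * f)) * (g * h) ≡ a * ((b * (h * f)) * g)
    regroup = solve-∀
    n!≡X*D : n ! ≡ X * D
    n!≡X*D = sym (begin
      X * D
        ≡⟨ regroup (n C ℓ) (ℓ C k) ((ℓ ∸ k) !) ((n ∸ ℓ) !) (k !) ⟩
      (n C ℓ) * (((ℓ C k) * (k ! * (ℓ ∸ k) !)) * (n ∸ ℓ) !)
        ≡⟨ cong (λ x → (n C ℓ) * (x * (n ∸ ℓ) !)) (nCk*[k!*[n∸k]!]≡n! k≤ℓ) ⟩
      (n C ℓ) * (ℓ ! * (n ∸ ℓ) !)
        ≡⟨ nCk*[k!*[n∸k]!]≡n! ℓ≤n ⟩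
      n ! ∎)
      where open ≡-Reasoning

open Binomial

module Markings where

  open import Data.Nat.Base using (_+_)
  open import Data.Nat.Properties using (+-suc; suc-injective; 1+n≰n; +-0-commutativeMonoid)
  open import Data.Product using (_×_)
  import Algebra.Properties.CommutativeMonoid.Sum as CommutativeMonoidSum

  -- h a ≡ just c marks the cell (a , c); the marked matrix has s + t at marked cells and t elsewhere.
  Marking : ℕ → Set
  Marking m = Fin m → Maybe (Fin m)

  PartialInjective : ∀ {m} → Marking m → Set
  PartialInjective h = ∀ {a b c} → h a ≡ just c → h b ≡ just c → a ≡ b

  module ℕΣ = CommutativeMonoidSum +-0-commutativeMonoid

  count : ∀ {n} → (Fin n → Bool) → ℕ
  count b = ℕΣ.sum (λ i → if b i then 1 else 0)

  marks : ∀ {m} → Marking m → ℕ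
  marks h = count (λ a → is-just (h a))

  count+count-not : ∀ {n} (b : Fin n → Bool) → count b + count (λ i → not (b i)) ≡ n
  count+count-not {zero}  b = refl
  count+count-not {suc n} b with b zero
  ... | true  = cong suc (count+count-not (λ i → b (suc i)))
  ... | false = trans (+-suc _ _) (cong suc (count+count-not (λ i → b (suc i))))

  dropZero : ∀ {m} → Maybe (Fin (suc m)) → Maybe (Fin m)
  dropZero (just (suc c)) = just c
  dropZero _              = nothing

  minorMarking : ∀ {m} → Marking (suc m) → Fin (suc m) → Marking m
  minorMarking h i c = dropZero (h (punchIn i c))

  clearColumnZero : ∀ {m} → Marking (suc m) → Marking (suc m)
  clearColumnZero h a = Maybe.map Fin.suc (dropZero (h a))

  dropZero-just : ∀ {m} {c} (x : Maybe (Fin (suc m))) → dropZero x ≡ just c → x ≡ just (suc c)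
  dropZero-just (just (suc c)) refl = refl

  is-just-map-suc : ∀ {m} (x : Maybe (Fin m)) → is-just (Maybe.map Fin.suc x) ≡ is-just x
  is-just-map-suc nothing  = refl
  is-just-map-suc (just c) = refl

  is-just-dropZero : ∀ {m} (x : Maybe (Fin (suc m))) → x ≢ just zero → is-just (dropZero x) ≡ is-just x
  is-just-dropZero nothing        _  = refl
  is-just-dropZero (just zero)    x≢0 = ⊥-elim (x≢0 refl)
  is-just-dropZero (just (suc c)) _  = refl

  clearColumnZero-just : ∀ {m} {c} (x : Maybe (Fin (suc m))) → Maybe.map Fin.suc (dropZero x) ≡ just c → x ≡ just c
  clearColumnZero-just (just (suc c)) refl = refl

  minorMarking-injective : ∀ {m} {h : Marking (suc m)} i → PartialInjective h → PartialInjective (minorMarking h i)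
  minorMarking-injective {h = h} i inj ha hb =
    punchIn-injective i _ _ (inj (dropZero-just (h (punchIn i _)) ha) (dropZero-just (h (punchIn i _)) hb))

  clearColumnZero-injective : ∀ {m} {h : Marking (suc m)} → PartialInjective h → PartialInjective (clearColumnZero h)
  clearColumnZero-injective {h = h} inj ha hb = inj (clearColumnZero-just (h _) ha) (clearColumnZero-just (h _) hb)

  marks-minorMarking : ∀ {m} (h : Marking (suc m)) i → (∀ c → h (punchIn i c) ≢ just zero) →
    marks h ≡ (if is-just (h i) then 1 else 0) + marks (minorMarking h i)
  marks-minorMarking h i off-column =
    trans (ℕΣ.sum-remove {i = i} (λ a → if is-just (h a) then 1 else 0))
          (cong ((if is-just (h i) then 1 else 0) +_)
                (ℕΣ.sum-cong-≋ (λ c → cong (λ x → if x then 1 else 0)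
                                            (sym (is-just-dropZero (h (punchIn i c)) (off-column c))))))

  marks-clearColumnZero : ∀ {m} (h : Marking (suc m)) {r} → h r ≡ just zero →
    marks (clearColumnZero h) ≡ marks (minorMarking h r)
  marks-clearColumnZero h {r} hr≡0 =
    trans (ℕΣ.sum-remove {i = r} (λ a → if is-just (clearColumnZero h a) then 1 else 0))
          (cong₂ _+_ (cong (λ x → if is-just (Maybe.map Fin.suc (dropZero x)) then 1 else 0) hr≡0)
                     (ℕΣ.sum-cong-≋ (λ c → cong (λ x → if x then 1 else 0)
                                                 (is-just-map-suc (dropZero (h (punchIn r c)))))))

  marks-columnZero : ∀ {m} (h : Marking (suc m)) {r} → PartialInjective h → h r ≡ just zero →
    marks h ≡ suc (marks (minorMarking h r))
  marks-columnZero h {r} inj hr≡0 =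
    trans (marks-minorMarking h r (λ c hc≡0 → punchInᵢ≢i r c (inj hc≡0 hr≡0)))
          (cong (λ x → (if is-just x then 1 else 0) + marks (minorMarking h r)) hr≡0)

  marks-minorMarking-unmarked : ∀ {m} (h : Marking (suc m)) i → (∀ a → h a ≢ just zero) →
    marks (minorMarking h i) ≡ (if is-just (h i) then marks h ∸ 1 else marks h)
  marks-minorMarking-unmarked h i unmarked0
    rewrite marks-minorMarking h i (λ c → unmarked0 (punchIn i c)) with is-just (h i)
  ... | true  = refl
  ... | false = refl

  columnZeroMarked? : ∀ {m} (h : Marking (suc m)) → Dec (∃ λ a → h a ≡ just zero)
  columnZeroMarked? h = any? (λ a → Maybe.≡-dec _≟_ (h a) (just zero))

  unmarkedRow : ∀ {m} (h : Marking (suc m)) → PartialInjective h → (∀ a → h a ≢ just zero) →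
    ∃ λ a → h a ≡ nothing
  unmarkedRow h inj unmarked0 with any? (λ a → Maybe.≡-dec _≟_ (h a) nothing)
  ... | yes found = found
  ... | no  none  = ⊥-elim (1+n≰n (injective⇒≤ column-injective))
    where
    column : ∀ a → ∃ λ c → h a ≡ just (suc c)
    column a with h a in eq
    ... | nothing      = ⊥-elim (none (a , eq))
    ... | just zero    = ⊥-elim (unmarked0 a eq)
    ... | just (suc c) = c , refl
    column-injective : ∀ {a b} → proj₁ (column a) ≡ proj₁ (column b) → a ≡ b
    column-injective {a} {b} eq = inj (proj₂ (column a)) (trans (proj₂ (column b)) (cong (λ c → just (suc c)) (sym eq)))

  unmarkedRows : ∀ {m} (h : Marking (suc m)) → PartialInjective h → (∀ a → h a ≢ just zero) →
    ∃ λ r → count (λ a → not (is-just (h a))) ≡ suc r × marks h + r ≡ m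
  unmarkedRows {m} h inj unmarked0 with unmarkedRow h inj unmarked0
  ... | a , ha≡nothing = r , unmarked≡1+r , suc-injective (begin
    suc (marks h + r)                            ≡⟨ sym (+-suc (marks h) r) ⟩
    marks h + suc r                              ≡⟨ cong (marks h +_) (sym unmarked≡1+r) ⟩
    marks h + count (λ b → not (is-just (h b)))  ≡⟨ count+count-not (λ b → is-just (h b)) ⟩
    suc m                                        ∎)
    where
    open ≡-Reasoning
    r : ℕ
    r = count (λ c → not (is-just (h (punchIn a c))))
    unmarked≡1+r : count (λ a → not (is-just (h a))) ≡ suc r
    unmarked≡1+r = trans (ℕΣ.sum-remove {i = a} (λ b → if not (is-just (h b)) then 1 else 0))
                         (cong (λ x → (if not (is-just x) then 1 else 0) + r) ha≡nothing)

  diagonalMarking : ∀ {m} → Marking m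
  diagonalMarking a = just a

  diagonalMarking-injective : ∀ {m} → PartialInjective (diagonalMarking {m})
  diagonalMarking-injective refl refl = refl

  marks-diagonalMarking : ∀ m → marks (diagonalMarking {m}) ≡ m
  marks-diagonalMarking zero    = refl
  marks-diagonalMarking (suc m) = cong suc (marks-diagonalMarking m)

open Markings

module Combinations where

  open import Data.Nat.Base using (_+_)
  open import Data.Fin.Properties using (suc-injective)
  open import Data.List.Properties using (length-++; length-map)
  open import Data.List.Relation.Unary.All.Properties using (++⁺; map⁺)
  open import Data.Nat.Combinatorics using (nCk+nC[k+1]≡[n+1]C[k+1])

  map-suc-injective : ∀ {n ℓ} (v : Vec (Fin n) ℓ) → Injective _≡_ _≡_ (lookup v) →
    Injective _≡_ _≡_ (lookup (Vec.map suc v))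
  map-suc-injective v inj {i} {j} eq = inj (suc-injective (trans (sym (lookup-map i suc v)) (trans eq (lookup-map j suc v))))

  zero∷map-suc-injective : ∀ {n ℓ} (v : Vec (Fin n) ℓ) → Injective _≡_ _≡_ (lookup v) →
    Injective _≡_ _≡_ (lookup (zero ∷ Vec.map suc v))
  zero∷map-suc-injective v inj {zero}  {zero}  eq = refl
  zero∷map-suc-injective v inj {zero}  {suc j} eq with () ← trans eq (lookup-map j suc v)
  zero∷map-suc-injective v inj {suc i} {zero}  eq with () ← trans (sym eq) (lookup-map i suc v)
  zero∷map-suc-injective v inj {suc i} {suc j} eq = cong suc (map-suc-injective v inj eq)

  combinations-injective : ∀ n ℓ → All (λ S → Injective _≡_ _≡_ (lookup S)) (combinations n ℓ)
  combinations-injective n       zero    = (λ { {()} }) ∷ []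
  combinations-injective zero    (suc ℓ) = []
  combinations-injective (suc n) (suc ℓ) =
    ++⁺ (map⁺ (All.map (λ {v} → zero∷map-suc-injective v) (combinations-injective n ℓ)))
        (map⁺ (All.map (λ {v} → map-suc-injective v) (combinations-injective n (suc ℓ))))

  length-combinations : ∀ n ℓ → length (combinations n ℓ) ≡ n C ℓ
  length-combinations n       zero    = refl
  length-combinations zero    (suc ℓ) = refl
  length-combinations (suc n) (suc ℓ) = begin
    length (List.map _ (combinations n ℓ) ++ List.map _ (combinations n (suc ℓ)))
      ≡⟨ length-++ (List.map _ (combinations n ℓ)) ⟩
    length (List.map _ (combinations n ℓ)) + length (List.map _ (combinations n (suc ℓ)))
      ≡⟨ cong₂ _+_ (length-map _ (combinations n ℓ)) (length-map _ (combinations n (suc ℓ))) ⟩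
    length (combinations n ℓ) + length (combinations n (suc ℓ))
      ≡⟨ cong₂ _+_ (length-combinations n ℓ) (length-combinations n (suc ℓ)) ⟩
    n C ℓ + n C suc ℓ
      ≡⟨ nCk+nC[k+1]≡[n+1]C[k+1] n ℓ ⟩
    suc n C suc ℓ ∎
    where open ≡-Reasoning

open Combinations

module _ {c ℓ′ : Level} (R : CommutativeRing c ℓ′) where

  open CommutativeRing R hiding (zero) renaming (refl to ≈-refl; sym to ≈-sym; trans to ≈-trans)
  open import Algebra.Properties.Semiring.Sum semiring
    using (sum; sum-syntax; sum-cong-≋; sum-cong-≗; sum-remove; ∑-distrib-+; *-distribˡ-sum; sum-init-last; sum-replicate-zero)
  open import Algebra.Properties.Semiring.Mult semiring using (_×_; ×-congʳ; ×-homo-+; ×-assocˡ; ×-comm-*)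
  open import Algebra.Properties.CommutativeSemigroup +-commutativeSemigroup using () renaming (x∙yz≈y∙xz to x+yz≈y+xz)
  open import Algebra.Properties.CommutativeSemigroup *-commutativeSemigroup using () renaming (x∙yz≈y∙xz to x*yz≈y*xz)
  open import Algebra.Properties.Semiring.Exp semiring using (_^_)
  open import Relation.Binary.Reasoning.Setoid setoid

  sumL-cong : ∀ {A : Set} {f g : A → Carrier} (xs : List A) → (∀ x → f x ≈ g x) → sumL R f xs ≈ sumL R g xs
  sumL-cong []       f≈g = ≈-refl
  sumL-cong (x ∷ xs) f≈g = +-cong (f≈g x) (sumL-cong xs f≈g)

  sumL-++ : ∀ {A : Set} (f : A → Carrier) (xs ys : List A) → sumL R f (xs ++ ys) ≈ sumL R f xs + sumL R f ys
  sumL-++ f []       ys = ≈-sym (+-identityˡ _)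
  sumL-++ f (x ∷ xs) ys = ≈-trans (+-congˡ (sumL-++ f xs ys)) (≈-sym (+-assoc _ _ _))

  sumL-concatMap : ∀ {A B : Set} (f : B → Carrier) (g : A → List B) (xs : List A) →
    sumL R f (concatMap g xs) ≈ sumL R (λ x → sumL R f (g x)) xs
  sumL-concatMap f g []       = ≈-refl
  sumL-concatMap f g (x ∷ xs) = ≈-trans (sumL-++ f (g x) _) (+-congˡ (sumL-concatMap f g xs))

  sumL-map : ∀ {A B : Set} (f : B → Carrier) (g : A → B) (xs : List A) →
    sumL R f (List.map g xs) ≡ sumL R (λ x → f (g x)) xs
  sumL-map f g []       = refl
  sumL-map f g (x ∷ xs) = cong (f (g x) +_) (sumL-map f g xs)

  sumL-tabulate : ∀ {A : Set} {n} (f : A → Carrier) (g : Fin n → A) → sumL R f (tabulate g) ≡ ∑[ i < n ] f (g i)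
  sumL-tabulate {n = zero}  f g = refl
  sumL-tabulate {n = suc n} f g = cong (f (g zero) +_) (sumL-tabulate f (λ i → g (suc i)))

  *-distribˡ-sumL : ∀ {A : Set} x (f : A → Carrier) (xs : List A) → x * sumL R f xs ≈ sumL R (λ y → x * f y) xs
  *-distribˡ-sumL x f []       = zeroʳ x
  *-distribˡ-sumL x f (y ∷ xs) = ≈-trans (distribˡ x _ _) (+-congˡ (*-distribˡ-sumL x f xs))

  sumL-sum-comm : ∀ {A : Set} {n} (h : A → Fin n → Carrier) (xs : List A) →
    sumL R (λ x → ∑[ i < n ] h x i) xs ≈ ∑[ i < n ] sumL R (λ x → h x i) xs
  sumL-sum-comm {n = n} h []       = ≈-sym (sum-replicate-zero n)
  sumL-sum-comm         h (x ∷ xs) =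
    ≈-trans (+-congˡ (sumL-sum-comm h xs)) (≈-sym (∑-distrib-+ (h x) (λ i → sumL R (λ y → h y i) xs)))

  sumL-const : ∀ {A : Set} {f : A → Carrier} {y} (xs : List A) → All (λ x → f x ≈ y) xs → sumL R f xs ≈ length xs × y
  sumL-const []       []           = ≈-refl
  sumL-const (x ∷ xs) (fx≈y ∷ all) = +-cong fx≈y (sumL-const xs all)

  prodF-cong : ∀ m {f g : Fin m → Carrier} → (∀ i → f i ≈ g i) → prodF R m f ≈ prodF R m g
  prodF-cong zero    f≈g = ≈-refl
  prodF-cong (suc m) f≈g = *-cong (f≈g zero) (prodF-cong m (λ i → f≈g (suc i)))

  prodF-insertAt : ∀ {B : Set} m i x (v : Vec B m) (f : Fin (suc m) → B → Carrier) →
    prodF R (suc m) (λ a → f a (lookup (insertAt i x v) a)) ≈ f i x * prodF R m (λ c → f (punchIn i c) (lookup v c))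
  prodF-insertAt m       zero    x v       f = ≈-refl
  prodF-insertAt (suc m) (suc i) x (y ∷ v) f =
    ≈-trans (*-congˡ (prodF-insertAt m i x v (λ a → f (suc a)))) (x*yz≈y*xz _ _ _)

  permanent-cong : ∀ {m} {W W′ : Matrix R m} → (∀ a b → W a b ≈ W′ a b) → permanent R W ≈ permanent R W′
  permanent-cong {m} W≈W′ = sumL-cong (permutations m) (λ σ → prodF-cong m (λ i → W≈W′ i _))

  minor : ∀ {m} → Matrix R (suc m) → Fin (suc m) → Matrix R m
  minor W i c d = W (punchIn i c) (suc d)

  permanent-expand : ∀ {m} (W : Matrix R (suc m)) →
    permanent R W ≈ ∑[ i < suc m ] (W i zero * permanent R (minor W i))
  permanent-expand {m} W = begin
    permanent R W
      ≈⟨ sumL-concatMap term insertions (permutations m) ⟩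
    sumL R (λ σ → sumL R term (insertions σ)) (permutations m)
      ≈⟨ sumL-cong (permutations m) expand-insertions ⟩
    sumL R (λ σ → ∑[ i < suc m ] minorTerm i σ) (permutations m)
      ≈⟨ sumL-sum-comm (λ σ i → minorTerm i σ) (permutations m) ⟩
    ∑[ i < suc m ] sumL R (minorTerm i) (permutations m)
      ≈⟨ sum-cong-≋ (λ i → ≈-sym (*-distribˡ-sumL (W i zero) (minorProduct i) (permutations m))) ⟩
    ∑[ i < suc m ] (W i zero * permanent R (minor W i)) ∎
    where
    term : Vec (Fin (suc m)) (suc m) → Carrier
    term σ = prodF R (suc m) (λ a → W a (lookup σ a))
    insertions : Vec (Fin m) m → List (Vec (Fin (suc m)) (suc m))
    insertions σ = List.map (λ i → insertAt i zero (Vec.map suc σ)) (allFin (suc m))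
    minorProduct : Fin (suc m) → Vec (Fin m) m → Carrier
    minorProduct i σ = prodF R m (λ c → minor W i c (lookup σ c))
    minorTerm : Fin (suc m) → Vec (Fin m) m → Carrier
    minorTerm i σ = W i zero * minorProduct i σ
    expand-insertions : ∀ σ → sumL R term (insertions σ) ≈ ∑[ i < suc m ] minorTerm i σ
    expand-insertions σ = begin
      sumL R term (insertions σ)
        ≡⟨ sumL-map term _ (allFin (suc m)) ⟩
      sumL R (λ i → term (insertAt i zero (Vec.map suc σ))) (allFin (suc m))
        ≡⟨ sumL-tabulate (λ i → term (insertAt i zero (Vec.map suc σ))) (λ i → i) ⟩
      ∑[ i < suc m ] term (insertAt i zero (Vec.map suc σ))
        ≈⟨ sum-cong-≋ (λ i → prodF-insertAt m i zero (Vec.map suc σ) W) ⟩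
      ∑[ i < suc m ] (W i zero * prodF R m (λ c → W (punchIn i c) (lookup (Vec.map suc σ) c)))
        ≈⟨ sum-cong-≋ (λ i → *-congˡ {W i zero}
             (prodF-cong m (λ c → reflexive (cong (W (punchIn i c)) (lookup-map c suc σ))))) ⟩
      ∑[ i < suc m ] minorTerm i σ ∎

  ×-distrib-sum : ∀ k {n} (f : Fin n → Carrier) → k × sum f ≈ ∑[ i < n ] (k × f i)
  ×-distrib-sum zero    {n} f = ≈-sym (sum-replicate-zero n)
  ×-distrib-sum (suc k)     f = ≈-trans (+-congˡ (×-distrib-sum k f)) (≈-sym (∑-distrib-+ f (λ i → k × f i)))

  sumBelow : ℕ → (ℕ → Carrier) → Carrier
  sumBelow n f = ∑[ j < n ] f (toℕ j)

  sumBelow-cong : ∀ n {f g : ℕ → Carrier} → (∀ j → j < n → f j ≈ g j) → sumBelow n f ≈ sumBelow n g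
  sumBelow-cong n f≈g = sum-cong-≋ (λ j → f≈g (toℕ j) (toℕ<n j))

  sumBelow-suc : ∀ n (f : ℕ → Carrier) → sumBelow (suc n) f ≈ sumBelow n f + f n
  sumBelow-suc n f = ≈-trans (sum-init-last (λ j → f (toℕ j)))
    (+-cong (sum-cong-≋ {n} (λ j → reflexive (cong f (toℕ-inject₁ j)))) (reflexive (cong f (toℕ-fromℕ n))))

  sumL-applyUpTo : ∀ n (f : ℕ → Carrier) (g : ℕ → ℕ) → sumL R f (List.applyUpTo g n) ≡ ∑[ j < n ] f (g (toℕ j))
  sumL-applyUpTo zero    f g = refl
  sumL-applyUpTo (suc n) f g = cong (f (g 0) +_) (sumL-applyUpTo n f (λ j → g (suc j)))

  ∑-if : ∀ {n} (b : Fin n → Bool) x y →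
    ∑[ i < n ] (if b i then x else y) ≈ count b × x + count (λ i → not (b i)) × y
  ∑-if {zero}  b x y = ≈-sym (+-identityʳ 0#)
  ∑-if {suc n} b x y with b zero
  ... | true  = ≈-trans (+-congˡ (∑-if (λ i → b (suc i)) x y)) (≈-sym (+-assoc _ _ _))
  ... | false = ≈-trans (+-congˡ (∑-if (λ i → b (suc i)) x y)) (x+yz≈y+xz _ _ _)

  module _ (s t : Carrier) where

    monomial : ℕ → ℕ → Carrier
    monomial m j = s ^ j * t ^ (m ∸ j)

    homogeneous : ℕ → (ℕ → ℕ) → Carrier
    homogeneous m a = sumBelow (suc m) (λ j → a j × monomial m j)

    homogeneous-cong : ∀ m {a b : ℕ → ℕ} → (∀ j → j ≤ m → a j ≡ b j) → homogeneous m a ≈ homogeneous m b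
    homogeneous-cong m a≡b = sumBelow-cong (suc m) (λ j j<1+m → reflexive (cong (_× monomial m j) (a≡b j (ℕₚ.≤-pred j<1+m))))

    homogeneous-+ : ∀ m (a b : ℕ → ℕ) → homogeneous m a + homogeneous m b ≈ homogeneous m (λ j → a j ℕ.+ b j)
    homogeneous-+ m a b =
      ≈-trans (≈-sym (∑-distrib-+ {suc m} (λ j → a (toℕ j) × monomial m (toℕ j)) (λ j → b (toℕ j) × monomial m (toℕ j))))
      (sumBelow-cong (suc m) (λ j _ → ≈-sym (×-homo-+ (monomial m j) (a j) (b j))))

    homogeneous-× : ∀ k m (a : ℕ → ℕ) → k × homogeneous m a ≈ homogeneous m (λ j → k ℕ.* a j)
    homogeneous-× k m a = ≈-trans (×-distrib-sum k {suc m} (λ j → a (toℕ j) × monomial m (toℕ j)))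
      (sumBelow-cong (suc m) (λ j _ → ×-assocˡ (monomial m j) k (a j)))

    shiftCoefficients : (ℕ → ℕ) → ℕ → ℕ
    shiftCoefficients a zero    = 0
    shiftCoefficients a (suc j) = a j

    s*homogeneous : ∀ m (a : ℕ → ℕ) → s * homogeneous m a ≈ homogeneous (suc m) (shiftCoefficients a)
    s*homogeneous m a = begin
      s * homogeneous m a
        ≈⟨ *-distribˡ-sum {suc m} s (λ j → a (toℕ j) × monomial m (toℕ j)) ⟩
      sumBelow (suc m) (λ j → s * (a j × monomial m j))
        ≈⟨ sumBelow-cong (suc m) (λ j _ → ×-comm-* (a j) s (monomial m j)) ⟩
      sumBelow (suc m) (λ j → a j × (s * monomial m j))
        ≈⟨ sumBelow-cong (suc m) (λ j _ → ×-congʳ (a j) (≈-sym (*-assoc s (s ^ j) (t ^ (m ∸ j))))) ⟩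
      sumBelow (suc m) (λ j → a j × monomial (suc m) (suc j))
        ≈⟨ ≈-sym (+-identityˡ _) ⟩
      homogeneous (suc m) (shiftCoefficients a) ∎

    t*homogeneous : ∀ m (a b : ℕ → ℕ) → (∀ j → j ≤ m → a j ≡ b j) → b (suc m) ≡ 0 →
      t * homogeneous m a ≈ homogeneous (suc m) b
    t*homogeneous m a b a≡b b[1+m]≡0 = begin
      t * homogeneous m a
        ≈⟨ *-distribˡ-sum {suc m} t (λ j → a (toℕ j) × monomial m (toℕ j)) ⟩
      sumBelow (suc m) (λ j → t * (a j × monomial m j))
        ≈⟨ sumBelow-cong (suc m) raise ⟩
      sumBelow (suc m) (λ j → b j × monomial (suc m) j)
        ≈⟨ ≈-sym (+-identityʳ _) ⟩
      sumBelow (suc m) (λ j → b j × monomial (suc m) j) + 0#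
        ≈⟨ +-congˡ (reflexive (cong (_× monomial (suc m) (suc m)) (sym b[1+m]≡0))) ⟩
      sumBelow (suc m) (λ j → b j × monomial (suc m) j) + b (suc m) × monomial (suc m) (suc m)
        ≈⟨ ≈-sym (sumBelow-suc (suc m) (λ j → b j × monomial (suc m) j)) ⟩
      homogeneous (suc m) b ∎
      where
      raise : ∀ j → j < suc m → t * (a j × monomial m j) ≈ b j × monomial (suc m) j
      raise j (s≤s j≤m) = begin
        t * (a j × (s ^ j * t ^ (m ∸ j)))
          ≈⟨ ×-comm-* (a j) t _ ⟩
        a j × (t * (s ^ j * t ^ (m ∸ j)))
          ≈⟨ ×-congʳ (a j) (x*yz≈y*xz t _ _) ⟩
        a j × (s ^ j * t ^ suc (m ∸ j))
          ≡⟨ cong₂ (λ c e → c × (s ^ j * t ^ e)) (a≡b j j≤m) (sym (ℕₚ.+-∸-assoc 1 j≤m)) ⟩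
        b j × monomial (suc m) j ∎

    -- Writing each marked entry as s + t: any j marked cells chosen to contribute s lie on (m - j)! permutations.
    markedPermanent : ℕ → ℕ → Carrier
    markedPermanent m k = homogeneous m (markedCoefficient m k)

    markedPermanent-zero : ∀ k → markedPermanent 0 k ≈ 1#
    markedPermanent-zero k = ≈-trans (+-identityʳ _) (≈-trans (+-identityʳ _) (*-identityˡ 1#))

    markedPermanent-suc-suc : ∀ m k → markedPermanent (suc m) (suc k) ≈ markedPermanent (suc m) k + s * markedPermanent m k
    markedPermanent-suc-suc m k = ≈-sym (begin
      markedPermanent (suc m) k + s * markedPermanent m k
        ≈⟨ +-congˡ (s*homogeneous m (markedCoefficient m k)) ⟩
      homogeneous (suc m) (markedCoefficient (suc m) k) + homogeneous (suc m) (shiftCoefficients (markedCoefficient m k))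
        ≈⟨ homogeneous-+ (suc m) (markedCoefficient (suc m) k) (shiftCoefficients (markedCoefficient m k)) ⟩
      homogeneous (suc m) (λ j → markedCoefficient (suc m) k j ℕ.+ shiftCoefficients (markedCoefficient m k) j)
        ≈⟨ homogeneous-cong (suc m) pascal ⟩
      markedPermanent (suc m) (suc k) ∎)
      where
      pascal : ∀ j → j ≤ suc m →
        markedCoefficient (suc m) k j ℕ.+ shiftCoefficients (markedCoefficient m k) j ≡ markedCoefficient (suc m) (suc k) j
      pascal zero    _ = ℕₚ.+-identityʳ _
      pascal (suc j) _ = sym (markedCoefficient-suc-suc m k j)

    -- The recursion when the first column has no mark: k rows are marked and r + 1 are not.
    markedPermanent-suc : ∀ {m k r} → k ℕ.+ r ≡ m →
      markedPermanent (suc m) k ≈ t * (k × markedPermanent m (k ∸ 1) + suc r × markedPermanent m k)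
    markedPermanent-suc {m} {k} {r} k+r≡m = ≈-sym (begin
      t * (k × markedPermanent m (k ∸ 1) + suc r × markedPermanent m k)
        ≈⟨ *-congˡ (+-cong (homogeneous-× k m (markedCoefficient m (k ∸ 1))) (homogeneous-× (suc r) m (markedCoefficient m k))) ⟩
      t * (homogeneous m (λ j → k ℕ.* markedCoefficient m (k ∸ 1) j) + homogeneous m (λ j → suc r ℕ.* markedCoefficient m k j))
        ≈⟨ *-congˡ (homogeneous-+ m (λ j → k ℕ.* markedCoefficient m (k ∸ 1) j)
                                    (λ j → suc r ℕ.* markedCoefficient m k j)) ⟩
      t * homogeneous m (λ j → k ℕ.* markedCoefficient m (k ∸ 1) j ℕ.+ suc r ℕ.* markedCoefficient m k j)
        ≈⟨ t*homogeneous m _ (markedCoefficient (suc m) k)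
                         (λ j → markedCoefficient-suc k+r≡m) (markedCoefficient-beyond {suc m} (s≤s k≤m)) ⟩
      markedPermanent (suc m) k ∎)
      where
      k≤m : k ≤ m
      k≤m = subst (k ≤_) k+r≡m (ℕₚ.m≤m+n k r)

    -- does rather than ⌊_⌋, so that mark (just (suc c)) (suc d) reduces to mark (just c) d.
    mark : ∀ {m} → Maybe (Fin m) → Fin m → Carrier
    mark nothing  d = t
    mark (just c) d = if does (c ≟ d) then s + t else t

    markedMatrix : ∀ {m} → Marking m → Matrix R m
    markedMatrix h a d = mark (h a) d

    mark-suc : ∀ {m} (x : Maybe (Fin (suc m))) d → mark x (suc d) ≡ mark (dropZero x) d
    mark-suc nothing        d = refl
    mark-suc (just zero)    d = refl
    mark-suc (just (suc c)) d = refl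

    mark-zero : ∀ {m} (x : Maybe (Fin (suc m))) → x ≢ just zero → mark x zero ≡ t
    mark-zero nothing        _   = refl
    mark-zero (just zero)    x≢0 = ⊥-elim (x≢0 refl)
    mark-zero (just (suc c)) _   = refl

    mark-cleared-zero : ∀ {m} (x : Maybe (Fin (suc m))) → mark (Maybe.map Fin.suc (dropZero x)) zero ≡ t
    mark-cleared-zero nothing        = refl
    mark-cleared-zero (just zero)    = refl
    mark-cleared-zero (just (suc c)) = refl

    mark-cleared-suc : ∀ {m} (x : Maybe (Fin (suc m))) d → mark (Maybe.map Fin.suc (dropZero x)) (suc d) ≡ mark x (suc d)
    mark-cleared-suc nothing        d = refl
    mark-cleared-suc (just zero)    d = refl
    mark-cleared-suc (just (suc c)) d = refl

    permanent-minor-markedMatrix : ∀ {m} (h : Marking (suc m)) i →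
      permanent R (minor (markedMatrix h) i) ≈ permanent R (markedMatrix (minorMarking h i))
    permanent-minor-markedMatrix h i = permanent-cong (λ c d → reflexive (mark-suc (h (punchIn i c)) d))

    permanent-expand-unmarked : ∀ {m} (h : Marking (suc m)) → (∀ a → h a ≢ just zero) →
      permanent R (markedMatrix h) ≈ t * ∑[ i < suc m ] permanent R (markedMatrix (minorMarking h i))
    permanent-expand-unmarked {m} h unmarked0 = begin
      permanent R (markedMatrix h)
        ≈⟨ permanent-expand (markedMatrix h) ⟩
      ∑[ i < suc m ] (mark (h i) zero * permanent R (minor (markedMatrix h) i))
        ≈⟨ sum-cong-≋ (λ i → *-cong (reflexive (mark-zero (h i) (unmarked0 i))) (permanent-minor-markedMatrix h i)) ⟩
      ∑[ i < suc m ] (t * permanent R (markedMatrix (minorMarking h i)))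
        ≈⟨ ≈-sym (*-distribˡ-sum t (λ i → permanent R (markedMatrix (minorMarking h i)))) ⟩
      t * ∑[ i < suc m ] permanent R (markedMatrix (minorMarking h i)) ∎

    -- Column zero is t everywhere plus s in row r, and the expansion is linear in that column.
    permanent-expand-marked : ∀ {m} (h : Marking (suc m)) {r} → PartialInjective h → h r ≡ just zero →
      permanent R (markedMatrix h) ≈
      permanent R (markedMatrix (clearColumnZero h)) + s * permanent R (markedMatrix (minorMarking h r))
    permanent-expand-marked {m} h {r} inj hr≡0 = begin
      permanent R (markedMatrix h)
        ≈⟨ expand-at-r h ⟩
      mark (h r) zero * M r + ∑[ c < m ] (mark (h (punchIn r c)) zero * M (punchIn r c))
        ≈⟨ +-cong (*-congʳ (reflexive (cong (λ x → mark x zero) hr≡0)))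
                  (sum-cong-≋ (λ c → *-congʳ (reflexive (mark-zero (h (punchIn r c)) (off-row c))))) ⟩
      (s + t) * M r + ∑[ c < m ] (t * M (punchIn r c))
        ≈⟨ +-congʳ (distribʳ (M r) s t) ⟩
      (s * M r + t * M r) + ∑[ c < m ] (t * M (punchIn r c))
        ≈⟨ +-assoc _ _ _ ⟩
      s * M r + (t * M r + ∑[ c < m ] (t * M (punchIn r c)))
        ≈⟨ +-comm _ _ ⟩
      (t * M r + ∑[ c < m ] (t * M (punchIn r c))) + s * M r
        ≈⟨ +-cong (≈-sym cleared) (*-congˡ (permanent-minor-markedMatrix h r)) ⟩
      permanent R (markedMatrix (clearColumnZero h)) + s * permanent R (markedMatrix (minorMarking h r)) ∎
      where
      M : Fin (suc m) → Carrier
      M i = permanent R (minor (markedMatrix h) i)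
      off-row : ∀ c → h (punchIn r c) ≢ just zero
      off-row c hc≡0 = punchInᵢ≢i r c (inj hc≡0 hr≡0)
      expand-at-r : ∀ h′ → permanent R (markedMatrix h′) ≈
        mark (h′ r) zero * permanent R (minor (markedMatrix h′) r) +
        ∑[ c < m ] (mark (h′ (punchIn r c)) zero * permanent R (minor (markedMatrix h′) (punchIn r c)))
      expand-at-r h′ = ≈-trans (permanent-expand (markedMatrix h′))
        (sum-remove {i = r} (λ i → mark (h′ i) zero * permanent R (minor (markedMatrix h′) i)))
      cleared-minor : ∀ i → permanent R (minor (markedMatrix (clearColumnZero h)) i) ≈ M i
      cleared-minor i = permanent-cong (λ c d → reflexive (mark-cleared-suc (h (punchIn i c)) d))
      cleared : permanent R (markedMatrix (clearColumnZero h)) ≈ t * M r + ∑[ c < m ] (t * M (punchIn r c))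
      cleared = ≈-trans (expand-at-r (clearColumnZero h))
        (+-cong (*-cong (reflexive (mark-cleared-zero (h r))) (cleared-minor r))
                (sum-cong-≋ (λ c → *-cong (reflexive (mark-cleared-zero (h (punchIn r c))))
                                          (cleared-minor (punchIn r c)))))

    PermanentFormula : ℕ → Set _
    PermanentFormula m = ∀ k (h : Marking m) → PartialInjective h → marks h ≡ k →
      permanent R (markedMatrix h) ≈ markedPermanent m k

    permanent-markedMatrix-unmarked : ∀ {m} → PermanentFormula m →
      ∀ k (h : Marking (suc m)) → PartialInjective h → (∀ a → h a ≢ just zero) → marks h ≡ k →
      permanent R (markedMatrix h) ≈ markedPermanent (suc m) k
    permanent-markedMatrix-unmarked {m} formula .(marks h) h inj unmarked0 refl = begin
      permanent R (markedMatrix h)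
        ≈⟨ permanent-expand-unmarked h unmarked0 ⟩
      t * ∑[ i < suc m ] permanent R (markedMatrix (minorMarking h i))
        ≈⟨ *-congˡ (sum-cong-≋ minor-permanent) ⟩
      t * ∑[ i < suc m ] (if is-just (h i) then P (k ∸ 1) else P k)
        ≈⟨ *-congˡ (∑-if (λ i → is-just (h i)) (P (k ∸ 1)) (P k)) ⟩
      t * (k × P (k ∸ 1) + unmarked × P k)
        ≡⟨ cong (λ u → t * (k × P (k ∸ 1) + u × P k)) unmarked≡1+r ⟩
      t * (k × P (k ∸ 1) + suc r × P k)
        ≈⟨ ≈-sym (markedPermanent-suc {m} {k} {r} k+r≡m) ⟩
      markedPermanent (suc m) k ∎
      where
      k : ℕ
      k = marks h
      P : ℕ → Carrier
      P = markedPermanent m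
      unmarked : ℕ
      unmarked = count (λ a → not (is-just (h a)))
      minor-permanent : ∀ i → permanent R (markedMatrix (minorMarking h i)) ≈ (if is-just (h i) then P (k ∸ 1) else P k)
      minor-permanent i = ≈-trans (formula _ (minorMarking h i) (minorMarking-injective i inj) refl)
        (reflexive (trans (cong P (marks-minorMarking-unmarked h i unmarked0)) (if-float P (is-just (h i)))))
      r : ℕ
      r = proj₁ (unmarkedRows h inj unmarked0)
      unmarked≡1+r : unmarked ≡ suc r
      unmarked≡1+r = proj₁ (proj₂ (unmarkedRows h inj unmarked0))
      k+r≡m : k ℕ.+ r ≡ m
      k+r≡m = proj₂ (proj₂ (unmarkedRows h inj unmarked0))

    permanent-markedMatrix-suc : ∀ {m} → PermanentFormula m → PermanentFormula (suc m)
    permanent-markedMatrix-suc formula zero h inj marks≡0 with columnZeroMarked? h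
    ... | yes (r , hr≡0)     with () ← trans (sym marks≡0) (marks-columnZero h inj hr≡0)
    ... | no column0-unmarked = permanent-markedMatrix-unmarked formula zero h inj (¬∃⟶∀¬ column0-unmarked) marks≡0
    permanent-markedMatrix-suc {m} formula (suc k) h inj marks≡1+k with columnZeroMarked? h
    ... | no column0-unmarked = permanent-markedMatrix-unmarked formula (suc k) h inj (¬∃⟶∀¬ column0-unmarked) marks≡1+k
    ... | yes (r , hr≡0) = begin
      permanent R (markedMatrix h)
        ≈⟨ permanent-expand-marked h inj hr≡0 ⟩
      permanent R (markedMatrix (clearColumnZero h)) + s * permanent R (markedMatrix (minorMarking h r))
        ≈⟨ +-cong (permanent-markedMatrix-suc formula k (clearColumnZero h) (clearColumnZero-injective inj)
                     (trans (marks-clearColumnZero h hr≡0) marks-minor≡k))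
                  (*-congˡ (formula k (minorMarking h r) (minorMarking-injective r inj) marks-minor≡k)) ⟩
      markedPermanent (suc m) k + s * markedPermanent m k
        ≈⟨ ≈-sym (markedPermanent-suc-suc m k) ⟩
      markedPermanent (suc m) (suc k) ∎
      where
      marks-minor≡k : marks (minorMarking h r) ≡ k
      marks-minor≡k = ℕₚ.suc-injective (trans (sym (marks-columnZero h inj hr≡0)) marks≡1+k)

    permanent-markedMatrix : ∀ m → PermanentFormula m
    permanent-markedMatrix zero    k h inj marks≡k = ≈-trans (+-identityʳ 1#) (≈-sym (markedPermanent-zero k))
    permanent-markedMatrix (suc m) = permanent-markedMatrix-suc (permanent-markedMatrix m)

    sI+tJ : ∀ {n} → Matrix R n
    sI+tJ = _+M_ R (_·M_ R s (identityM R)) (_·M_ R t (onesM R))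

    sI+tJ-entry : ∀ b → s * (if b then 1# else 0#) + t * 1# ≈ (if b then s + t else t)
    sI+tJ-entry true  = +-cong (*-identityʳ s) (*-identityʳ t)
    sI+tJ-entry false = ≈-trans (+-cong (zeroʳ s) (*-identityʳ t)) (+-identityˡ t)

    isYes-lookup : ∀ {n ℓ} (S : Vec (Fin n) ℓ) → Injective _≡_ _≡_ (lookup S) →
      ∀ i j → ⌊ lookup S i ≟ lookup S j ⌋ ≡ does (i ≟ j)
    isYes-lookup S inj i j with i ≟ j | lookup S i ≟ lookup S j
    ... | yes _    | yes _  = refl
    ... | yes refl | no Si≢Si = ⊥-elim (Si≢Si refl)
    ... | no i≢j   | yes Si≡Sj = ⊥-elim (i≢j (inj Si≡Sj))
    ... | no _     | no _   = refl

    vee-sI+tJ-diagonal : ∀ {n ℓ} (S : Vec (Fin n) ℓ) → Injective _≡_ _≡_ (lookup S) →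
      vee R sI+tJ ℓ S S ≈ markedPermanent ℓ ℓ
    vee-sI+tJ-diagonal {ℓ = ℓ} S inj = ≈-trans
      (permanent-cong (λ i j →
        ≈-trans (reflexive (cong (λ b → s * (if b then 1# else 0#) + t * 1#) (isYes-lookup S inj i j)))
                (sI+tJ-entry (does (i ≟ j)))))
      (permanent-markedMatrix ℓ ℓ diagonalMarking diagonalMarking-injective (marks-diagonalMarking ℓ))

    traceVee-sI+tJ : ∀ n ℓ → traceVee R {n} sI+tJ ℓ ≈ (n C ℓ) × markedPermanent ℓ ℓ
    traceVee-sI+tJ n ℓ = ≈-trans
      (sumL-const (combinations n ℓ) (All.map (λ {S} → vee-sI+tJ-diagonal S) (combinations-injective n ℓ)))
      (reflexive (cong (_× markedPermanent ℓ ℓ) (length-combinations n ℓ)))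

    binomial×markedPermanent : ∀ {n ℓ} → ℓ ≤ n → (n C ℓ) × markedPermanent ℓ ℓ ≈ homogeneous ℓ (coeff n ℓ)
    binomial×markedPermanent {n} {ℓ} ℓ≤n = ≈-trans (homogeneous-× (n C ℓ) ℓ (markedCoefficient ℓ ℓ))
      (homogeneous-cong ℓ (λ j j≤ℓ → sym (coeff≡nCℓ*markedCoefficient j≤ℓ ℓ≤n)))

    ×≡Defs× : ∀ k x → k × x ≡ Defs._×_ R k x
    ×≡Defs× zero    x = refl
    ×≡Defs× (suc k) x = cong (x +_) (×≡Defs× k x)

    ^≡Defs^ : ∀ x k → x ^ k ≡ Defs._^_ R x k
    ^≡Defs^ x zero    = refl
    ^≡Defs^ x (suc k) = cong (x *_) (^≡Defs^ x k)

    homogeneous≡sumL : ∀ m a →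
      homogeneous m a ≡ sumL R (λ j → Defs._×_ R (a j) (Defs._^_ R s j * Defs._^_ R t (m ∸ j))) (upTo (suc m))
    homogeneous≡sumL m a = sym (trans (sumL-applyUpTo (suc m) _ (λ j → j)) (sum-cong-≗ {suc m} (λ j →
      sym (trans (×≡Defs× (a (toℕ j)) _)
                 (cong (Defs._×_ R (a (toℕ j))) (cong₂ _*_ (^≡Defs^ s (toℕ j)) (^≡Defs^ t (m ∸ toℕ j))))))))

open Defs using (_×_; _^_)

proposition4p4 : ∀ {c ℓ′ : Level} (R : CommutativeRing c ℓ′) (n ℓ : ℕ) → ℓ ≤ n →
    (s t : CommutativeRing.Carrier R) →
    CommutativeRing._≈_ R
      (traceVee R {n} (_+M_ R (_·M_ R s (identityM R)) (_·M_ R t (onesM R))) ℓ)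
      (sumL R (λ k → _×_ R (coeff n ℓ k) (CommutativeRing._*_ R (_^_ R s k) (_^_ R t (ℓ ∸ k)))) (upTo (Data.Nat.suc ℓ)))
proposition4p4 R n ℓ ℓ≤n s t =
  ≈-trans (traceVee-sI+tJ R s t n ℓ) (
  ≈-trans (binomial×markedPermanent R s t ℓ≤n)
          (≈-reflexive (homogeneous≡sumL R s t ℓ (coeff n ℓ))))
  where open CommutativeRing R using () renaming (trans to ≈-trans; reflexive to ≈-reflexive)
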